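{- For every digraph $D$, there exists a dominating broadcast $f$ of $D$ of minimum cost such that every vertex $v$ with $f(v)>0$ is covered only by itself, i.e. there is no vertex $u\neq v$ with $f(u)>0$ and $d(u,v)\le f(u)$.
   Context: Digraphs are finite. For vertices $u,v$ of a digraph $D$, $d(u,v)$ is the length of a shortest directed path from $u$ to $v$ ($\infty$ if none). A dominating broadcast of $D$ is a function $f:V(D)\to\mathbb{N}$ such that for every vertex $v$ there is a vertex $t$ with $f(t)>0$ and $d(t,v)\le f(t)$ (we then say $t$ covers $v$); its cost is $\sum_v f(v)$. -}

module Defs where

open import Data.Nat using (ℕ; zero; suc; _≤_; _<_)
open import Data.Fin using (Fin)
open import Data.Bool using (Bool; T)
open import Data.Product using (Σ; ∃; _×_; _,_)
open import Data.Vec.Functional using (foldr)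
open import Data.Nat using (_+_)
open import Relation.Binary.PropositionalEquality using (_≡_)
open import Relation.Nullary using (¬_)

record Digraph : Set where
  field
    n   : ℕ
    arc : Fin n → Fin n → Bool

open Digraph public

Vertex : Digraph → Set
Vertex D = Fin (n D)

data Walk (D : Digraph) : Vertex D → Vertex D → ℕ → Set where
  here : ∀ {u} → Walk D u u zero
  step : ∀ {u w v m} → T (arc D u w) → Walk D w v m → Walk D u v (suc m)

-- d(u,v) ≤ k : there is a directed path (equivalently walk) of length ≤ k.
-- (If d(u,v) = ∞, this never holds.)
DistLe : (D : Digraph) → Vertex D → Vertex D → ℕ → Set
DistLe D u v k = Σ ℕ λ m → m ≤ k × Walk D u v m

Broadcast : Digraph → Set
Broadcast D = Vertex D → ℕ

Covers : (D : Digraph) → Broadcast D → Vertex D → Vertex D → Set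
Covers D f t v = (0 < f t) × DistLe D t v (f t)

IsDominating : (D : Digraph) → Broadcast D → Set
IsDominating D f = ∀ v → ∃ λ t → Covers D f t v

cost : (D : Digraph) → Broadcast D → ℕ
cost D f = foldr _+_ 0 f

IsMinimumDominating : (D : Digraph) → Broadcast D → Set
IsMinimumDominating D f =
  IsDominating D f × (∀ g → IsDominating D g → cost D f ≤ cost D g)

SelfCoveredOnly : (D : Digraph) → Broadcast D → Set
SelfCoveredOnly D f = ∀ v → 0 < f v → ∀ u → ¬ (u ≡ v) → ¬ Covers D f u v

-- Start from any minimum dominating broadcast f. While some broadcasting vertex
-- v is covered by a vertex u ≠ v, move the whole power f(v) onto u: the cost is
-- unchanged, every vertex formerly covered by v is now covered by u (walk from
-- u to v, then on from v), and v stops broadcasting while u already did, so the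
-- number of broadcasting vertices drops and the process terminates.
module Submission where

open import Defs
open import Data.Fin.Base using (Fin; zero; suc)
import Data.Fin.Properties as Fin
open import Data.Nat.Base using (ℕ; zero; suc; _+_; _∸_; _≤_; _<_; z≤n; s≤s)
open import Data.Nat.Induction using (<-wellFounded)
open import Data.Nat.Properties
open import Algebra.Properties.CommutativeMonoid.Sum +-0-commutativeMonoid using (sum)
open import Data.Product.Base using (Σ; ∃; ∃₂; _×_; _,_; proj₁)
open import Data.Sum.Base using (inj₁; inj₂)
open import Data.Vec.Functional using (Vector; []; _∷_; head; tail; map; updateAt)
open import Data.Vec.Functional.Properties using (updateAt-updates; updateAt-minimal)
open import Function.Base using (id; const)
open import Induction.WellFounded using (Acc; acc)
open import Relation.Nullary.Decidable using (Dec; yes; no; map′; T?; ¬?; _×-dec_; _⊎-dec_)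
open import Relation.Nullary.Negation using (¬_)
open import Relation.Unary using (Pred; Decidable)
open import Relation.Binary.PropositionalEquality
  using (_≡_; _≢_; _≗_; refl; sym; trans; cong; subst; module ≡-Reasoning)

sum-map-updateAt : ∀ {n} (w : ℕ → ℕ) (xs : Vector ℕ n) i (g : ℕ → ℕ) →
  sum (map w (updateAt xs i g)) + w (xs i) ≡ sum (map w xs) + w (g (xs i))
sum-map-updateAt w xs zero g = begin
  w (g x) + s + w x ≡⟨ +-assoc (w (g x)) s (w x) ⟩
  w (g x) + (s + w x) ≡⟨ +-comm (w (g x)) (s + w x) ⟩
  s + w x + w (g x) ≡⟨ cong (_+ w (g x)) (+-comm s (w x)) ⟩
  w x + s + w (g x) ∎
  where
  open ≡-Reasoning
  x = head xs
  s = sum (map w (tail xs))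
sum-map-updateAt w xs (suc i) g = begin
  w (head xs) + s′ + w (xs (suc i)) ≡⟨ +-assoc (w (head xs)) s′ _ ⟩
  w (head xs) + (s′ + w (xs (suc i))) ≡⟨ cong (w (head xs) +_) (sum-map-updateAt w (tail xs) i g) ⟩
  w (head xs) + (s + w (g (xs (suc i)))) ≡⟨ +-assoc (w (head xs)) s _ ⟨
  w (head xs) + s + w (g (xs (suc i))) ∎
  where
  open ≡-Reasoning
  s = sum (map w (tail xs))
  s′ = sum (map w (updateAt (tail xs) i g))

module _ {p} {P : Pred ℕ p} (P? : Decidable P) where

  ∃-least : ∀ {m} → P m → ∃ λ k → P k × (∀ {j} → P j → k ≤ j)
  ∃-least {m} = go m (<-wellFounded m)
    where
    go : ∀ m → Acc _<_ m → P m → ∃ λ k → P k × (∀ {j} → P j → k ≤ j)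
    go m (acc rs) pm with anyUpTo? P? m
    ... | yes (k , k<m , pk) = go k (rs k<m) pk
    ... | no ¬below = m , pm , λ pj → ≮⇒≥ (λ j<m → ¬below (_ , j<m , pj))

sum≤-search : ∀ {n p} {P : Pred (Vector ℕ n) p} → Decidable P →
  (∀ {g h} → g ≗ h → P g → P h) →
  ∀ c → Dec (∃ λ g → sum g ≤ c × P g)
sum≤-search {zero} P? resp c = map′
  (λ p → [] , z≤n , p)
  (λ (g , _ , p) → resp {h = []} (λ ()) p)
  (P? [])
sum≤-search {suc n} {P = P} P? resp c = map′ cons uncons (anyUpTo? Head? (suc c))
  where
  Head : ℕ → Set _
  Head a = ∃ λ h → sum h ≤ c ∸ a × P (a ∷ h)
  Head? : Decidable Head
  Head? a = sum≤-search (λ h → P? (a ∷ h))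
    (λ g≗h → resp λ { zero → refl ; (suc i) → g≗h i }) (c ∸ a)
  cons : (∃ λ a → a < suc c × Head a) → ∃ λ g → sum g ≤ c × P g
  cons (a , s≤s a≤c , h , h≤ , p) =
    a ∷ h , ≤-trans (+-monoʳ-≤ a h≤) (≤-reflexive (m+[n∸m]≡n a≤c)) , p
  uncons : (∃ λ g → sum g ≤ c × P g) → ∃ λ a → a < suc c × Head a
  uncons (g , g≤ , p) =
    head g , s≤s (≤-trans (m≤m+n (head g) _) g≤) , tail g ,
    subst (_≤ c ∸ head g) (m+n∸m≡n (head g) _) (∸-monoˡ-≤ (head g) g≤) ,
    resp (λ { zero → refl ; (suc i) → refl }) p

∃-minimum-sum : ∀ {n p} {P : Pred (Vector ℕ n) p} → Decidable P →
  (∀ {g h} → g ≗ h → P g → P h) → ∀ {g} → P g →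
  ∃ λ f → P f × (∀ h → P h → sum f ≤ sum h)
∃-minimum-sum P? resp {g} pg
  with ∃-least (sum≤-search P? resp) (g , ≤-refl , pg)
... | _ , (f , f≤k , pf) , least = f , pf , λ h ph → ≤-trans f≤k (least (h , ≤-refl , ph))

module _ {D : Digraph} where

  _++ʷ_ : ∀ {u w v a b} → Walk D u w a → Walk D w v b → Walk D u v (a + b)
  here ++ʷ q = q
  step e p ++ʷ q = step e (p ++ʷ q)

  DistLe-trans : ∀ {u w v a b} → DistLe D u w a → DistLe D w v b → DistLe D u v (a + b)
  DistLe-trans (m , m≤a , p) (m′ , m′≤b , q) = m + m′ , +-mono-≤ m≤a m′≤b , p ++ʷ q

  DistLe-mono : ∀ {u v a b} → a ≤ b → DistLe D u v a → DistLe D u v b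
  DistLe-mono a≤b (m , m≤a , p) = m , ≤-trans m≤a a≤b , p

  DistLe? : ∀ k u v → Dec (DistLe D u v k)
  DistLe? zero u v = map′
    (λ { refl → 0 , z≤n , here })
    (λ { (0 , z≤n , here) → refl })
    (u Fin.≟ v)
  DistLe? (suc k) u v = map′
    (λ { (inj₁ refl) → 0 , z≤n , here
       ; (inj₂ (w , e , m , m≤k , p)) → suc m , s≤s m≤k , step e p })
    (λ { (zero , _ , here) → inj₁ refl
       ; (suc m , s≤s m≤k , step e p) → inj₂ (_ , e , m , m≤k , p) })
    ((u Fin.≟ v) ⊎-dec Fin.any? λ w → T? (arc D u w) ×-dec DistLe? k w v)

  module _ (f : Broadcast D) where

    Covers? : ∀ t v → Dec (Covers D f t v)
    Covers? t v = (0 <? f t) ×-dec DistLe? (f t) t v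

    IsDominating? : Dec (IsDominating D f)
    IsDominating? = Fin.all? λ v → Fin.any? λ t → Covers? t v

    Violation : Set
    Violation = ∃₂ λ u v → u ≢ v × 0 < f v × Covers D f u v

    Violation? : Dec Violation
    Violation? = Fin.any? λ u → Fin.any? λ v →
      ¬? (u Fin.≟ v) ×-dec (0 <? f v) ×-dec Covers? u v

    ¬Violation⇒SelfCoveredOnly : ¬ Violation → SelfCoveredOnly D f
    ¬Violation⇒SelfCoveredOnly ¬viol v 0<fv u u≢v cov = ¬viol (u , v , u≢v , 0<fv , cov)

  IsDominating-resp-≗ : ∀ {f g} → f ≗ g → IsDominating D f → IsDominating D g
  IsDominating-resp-≗ f≗g dom v with dom v
  ... | t , 0<ft , dist = t , subst (0 <_) (f≗g t) 0<ft , subst (DistLe D t v) (f≗g t) dist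

  ∃-minimumDominating : Σ (Broadcast D) (IsMinimumDominating D)
  ∃-minimumDominating = ∃-minimum-sum IsDominating? IsDominating-resp-≗ everyoneBroadcasts
    where
    everyoneBroadcasts : IsDominating D (const 1)
    everyoneBroadcasts v = v , s≤s z≤n , 0 , z≤n , here

signum : ℕ → ℕ
signum zero = 0
signum (suc _) = 1

signum-pos : ∀ {m} → 0 < m → signum m ≡ 1
signum-pos {suc _} _ = refl

support : ∀ {n} → Vector ℕ n → ℕ
support f = sum (map signum f)

transfer : ∀ {n} → Vector ℕ n → (v u : Fin n) → Vector ℕ n
transfer f v u = updateAt (updateAt f v (const 0)) u (_+ f v)

module _ {n} (f : Vector ℕ n) {u v : Fin n} (u≢v : u ≢ v) where

  private
    silenced : Vector ℕ n
    silenced = updateAt f v (const 0)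

    silenced-u : silenced u ≡ f u
    silenced-u = updateAt-minimal u v f u≢v

  transfer-target : transfer f v u u ≡ f u + f v
  transfer-target = trans (updateAt-updates u silenced) (cong (_+ f v) silenced-u)

  transfer-≥ : ∀ {w} → w ≢ v → f w ≤ transfer f v u w
  transfer-≥ {w} w≢v with w Fin.≟ u
  ... | yes refl = ≤-trans (m≤m+n (f u) (f v)) (≤-reflexive (sym transfer-target))
  ... | no w≢u = ≤-reflexive (sym (trans (updateAt-minimal w u silenced w≢u)
                                          (updateAt-minimal w v f w≢v)))

  sum-transfer : sum (transfer f v u) ≡ sum f
  sum-transfer = +-cancelʳ-≡ (f u) _ _ (begin
    sum (transfer f v u) + f u          ≡⟨ cong (sum (transfer f v u) +_) silenced-u ⟨
    sum (transfer f v u) + silenced u   ≡⟨ sum-map-updateAt id silenced u (_+ f v) ⟩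
    sum silenced + (silenced u + f v)   ≡⟨ cong (λ x → sum silenced + (x + f v)) silenced-u ⟩
    sum silenced + (f u + f v)          ≡⟨ cong (sum silenced +_) (+-comm (f u) (f v)) ⟩
    sum silenced + (f v + f u)          ≡⟨ +-assoc (sum silenced) (f v) (f u) ⟨
    sum silenced + f v + f u            ≡⟨ cong (_+ f u) (sum-map-updateAt id f v (const 0)) ⟩
    sum f + 0 + f u                     ≡⟨ cong (_+ f u) (+-identityʳ (sum f)) ⟩
    sum f + f u                         ∎)
    where
    open ≡-Reasoning

  support-transfer : 0 < f u → 0 < f v → support (transfer f v u) < support f
  support-transfer 0<fu 0<fv = ≤-reflexive (begin
    suc (support (transfer f v u))               ≡⟨ +-comm 1 _ ⟩
    support (transfer f v u) + 1                 ≡⟨ cong (support (transfer f v u) +_) (signum-pos 0<su) ⟨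
    support (transfer f v u) + signum (silenced u) ≡⟨ sum-map-updateAt signum silenced u (_+ f v) ⟩
    support silenced + signum (silenced u + f v) ≡⟨ cong (support silenced +_) (signum-pos 0<su+fv) ⟩
    support silenced + 1                         ≡⟨ cong (support silenced +_) (signum-pos 0<fv) ⟨
    support silenced + signum (f v)              ≡⟨ sum-map-updateAt signum f v (const 0) ⟩
    support f + 0                                ≡⟨ +-identityʳ (support f) ⟩
    support f                                    ∎)
    where
    open ≡-Reasoning
    0<su : 0 < silenced u
    0<su = subst (0 <_) (sym silenced-u) 0<fu
    0<su+fv : 0 < silenced u + f v
    0<su+fv = ≤-trans 0<su (m≤m+n _ _)

module _ {D : Digraph} {f : Broadcast D} {u v : Vertex D} (u≢v : u ≢ v) where

  transfer-isDominating : Covers D f u v → IsDominating D f → IsDominating D (transfer f v u)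
  transfer-isDominating (0<fu , u→v) dom w with dom w
  ... | t , 0<ft , t→w with t Fin.≟ v
  ... | yes refl = u , ≤-trans 0<fu (transfer-≥ f u≢v u≢v) ,
    subst (DistLe D u w) (sym (transfer-target f u≢v)) (DistLe-trans u→v t→w)
  ... | no t≢v = t , ≤-trans 0<ft (transfer-≥ f u≢v t≢v) , DistLe-mono (transfer-≥ f u≢v t≢v) t→w

  transfer-isMinimumDominating : Covers D f u v →
    IsMinimumDominating D f → IsMinimumDominating D (transfer f v u)
  transfer-isMinimumDominating cov (dom , min) =
    transfer-isDominating cov dom ,
    λ g dom-g → subst (_≤ cost D g) (sym (sum-transfer f u≢v)) (min g dom-g)

∃-selfCoveredOnly-minimumDominating : ∀ {D} f → Acc _<_ (support f) → IsMinimumDominating D f →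
  Σ (Broadcast D) λ f → IsMinimumDominating D f × SelfCoveredOnly D f
∃-selfCoveredOnly-minimumDominating f (acc rs) min with Violation? f
... | no ¬viol = f , min , ¬Violation⇒SelfCoveredOnly f ¬viol
... | yes (u , v , u≢v , 0<fv , cov) = ∃-selfCoveredOnly-minimumDominating (transfer f v u)
  (rs (support-transfer f u≢v (proj₁ cov) 0<fv)) (transfer-isMinimumDominating u≢v cov min)

proposition4 : (D : Digraph) →
    Σ (Broadcast D) λ f → IsMinimumDominating D f × SelfCoveredOnly D f
proposition4 D with ∃-minimumDominating {D}
... | f , min = ∃-selfCoveredOnly-minimumDominating f (<-wellFounded (support f)) min
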